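{- Let $n\ge3$ and let $A[1..n]$ contain a uniformly random permutation of $\{1,\dots,n\}$; let $P=\min\{A[1],A[n]\}$ and $Q=\max\{A[1],A[n]\}$. Run the partitioning step (described in the context) on $A[1..n]$ and let $\mathcal K$ be the set of values the pointer $k$ has when the comparison $A[k]<p$ is evaluated. Let $s@K$ denote the number of positions $i\in\mathcal K$ such that initially $A[i]<P$. Then, conditional on $(P,Q)=(p,q)$, $s@K$ has the hypergeometric distribution $\mathrm{HypG}(p-1,q-2,n-2)$.
   Context: $\mathrm{HypG}(k,r,N)$ denotes the distribution of the number of red balls obtained when drawing $k$ times without replacement from an urn with $N$ balls of which $r$ are red. Partitioning step on $A[1..n]$: $p\gets\min(A[1],A[n])$, $q\gets\max(A[1],A[n])$; $\ell\gets2$, $g\gets n-1$, $k\gets2$. While $k\le g$: (i) if $A[k]<p$: swap $A[k],A[\ell]$, $\ell\gets\ell+1$; (ii) else if $A[k]\ge q$: while ($A[g]>q$ and $k<g$) do $g\gets g-1$; then if $A[g]\ge p$ swap $A[k],A[g]$, else {swap $A[k],A[g]$; swap $A[k],A[\ell]$; $\ell\gets\ell+1$}; then $g\gets g-1$; (iii) $k\gets k+1$. -}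

module Defs where

open import Data.Nat using (ℕ; zero; suc; _∸_; _≤ᵇ_; _<ᵇ_; _≡ᵇ_; _≤?_)
open import Data.Nat.Combinatorics using (_C_)
open import Data.Nat.Base using (_*_; _<_)
open import Data.Bool using (Bool; true; false; if_then_else_; _∧_)
open import Data.List using (List; []; _∷_; length; filter; map; upTo)
open import Data.Vec using (Vec; toList)
open import Data.List.Relation.Binary.Permutation.Propositional using (_↭_)
open import Data.Nat.Properties using (_<?_)
open import Relation.Nullary using (yes; no)

-- An array A[1..n] is modelled as a function from positions to values;
-- positions outside 1..n are never read by the algorithm.
Array : Set
Array = ℕ → ℕ

-- 1-indexed read of a list (0 outside the range 1..length).
get : List ℕ → ℕ → ℕ
get []       _             = 0
get (x ∷ xs) zero          = 0
get (x ∷ xs) (suc zero)    = x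
get (x ∷ xs) (suc (suc i)) = get xs (suc i)

arr : ∀ {n} → Vec ℕ n → Array
arr v = get (toList v)

swap : Array → ℕ → ℕ → Array
swap A i j x = if x ≡ᵇ i then A j else (if x ≡ᵇ j then A i else A x)

IsPerm : (n : ℕ) → Vec ℕ n → Set
IsPerm n v = toList v ↭ map suc (upTo n)

Pval : ∀ {n} → Vec ℕ n → ℕ
Pval {n} v = Data.Nat._⊓_ (arr v 1) (arr v n)

Qval : ∀ {n} → Vec ℕ n → ℕ
Qval {n} v = Data.Nat._⊔_ (arr v 1) (arr v n)

-- inner loop: while (A[g] > q and k < g) do g ← g-1 ; returns final g.
-- fuel: g strictly decreases, so fuel ≥ g suffices.
innerLoop : (fuel : ℕ) → Array → (q k g : ℕ) → ℕ
innerLoop zero       A q k g = g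
innerLoop (suc fuel) A q k g =
  if (q <ᵇ A g) ∧ (k <ᵇ g) then innerLoop fuel A q k (g ∸ 1) else g

-- outer loop; returns the list of values of k at which the comparison
-- A[k] < p is evaluated (one per iteration, at the start of the body).
-- fuel: k increases by one in every iteration and k ≤ g ≤ n-1, so fuel n suffices.
outerLoop : (fuel innerFuel : ℕ) → Array → (p q ℓ g k : ℕ) → List ℕ
outerLoop zero       _  A p q ℓ g k = []
outerLoop (suc fuel) iF A p q ℓ g k =
  if k ≤ᵇ g then k ∷ body else []
  where
  body : List ℕ
  body =
    if A k <ᵇ p then outerLoop fuel iF (swap A k ℓ) p q (suc ℓ) g (suc k)
    else (if q ≤ᵇ A k
      then (let g′ = innerLoop iF A q k g in
            if p ≤ᵇ A g′
              then outerLoop fuel iF (swap A k g′) p q ℓ (g′ ∸ 1) (suc k)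
              else outerLoop fuel iF (swap (swap A k g′) k ℓ) p q (suc ℓ) (g′ ∸ 1) (suc k))
      else outerLoop fuel iF A p q ℓ g (suc k))

Kset : ∀ {n} → Vec ℕ n → List ℕ
Kset {n} v = outerLoop n n (arr v) (Pval v) (Qval v) 2 (n ∸ 1) 2

sAtK : ∀ {n} → Vec ℕ n → ℕ
sAtK v = length (filter (λ i → arr v i <? Pval v) (Kset v))

-- Numerator of the HypG(k,r,N) probability mass at j:
-- Pr[X = j] = hypNum k r N j / (N C k), with hypNum = C(r,j)·C(N-r,k-j) for j ≤ k, else 0.
hypNum : (k r N j : ℕ) → ℕ
hypNum k r N j with j ≤? k
... | yes _ = (r C j) * ((N ∸ r) C (k ∸ j))
... | no  _ = 0

-- Conditioned on (P, Q) = (p, q), the array reads p, w, q or q, w, p, where w runs over all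
-- arrangements of the other n - 2 values, each exactly once.  Call a value large if it exceeds q.
-- The scan keeps g + #{large initial values at positions 2 .. k-1} + #{large ones at g+1 .. n-1}
-- equal to n - 1, since each large value passed by k costs one decrement of g and each one skipped
-- by the inner loop another.  With n - q large values in all, the scan ends at g = q - 1, so 𝒦 is
-- {2, …, q-1}, possibly extended by position q when that holds a large value, which is not below p.
-- Hence s@K counts the values below p among the first q - 2 entries of w, and counting the
-- arrangements of p - 1 such values and n - p - 1 others with exactly j of them in a prefix of
-- length q - 2 gives C(q-2, j) C(n-q, p-1-j) (p-1)! (n-p-1)! out of (n-2)!.

module Submission where

open import Defs
open import Data.Bool using (Bool; true; false; T; if_then_else_; not)
open import Data.List using (List; []; _∷_; _++_; [_]; map; length; filter; take; upTo; applyUpTo)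
open import Data.List.Properties using (length-++; length-map; map-∘; map-applyUpTo; map-cong-local; take-all; ++-identityʳ)
open import Data.List.Membership.Propositional using (_∈_; _∉_)
open import Data.List.Membership.Propositional.Properties
  using (∈-map⁺; ∈-map⁻; ∈-++⁺ˡ; ∈-++⁺ʳ; ∈-++⁻; ∈-filter⁺; ∈-filter⁻)
open import Data.List.Relation.Unary.All as All using ()
open import Data.List.Relation.Unary.AllPairs using ([]; _∷_)
open import Data.List.Relation.Unary.Any using (here; there)
open import Data.List.Relation.Unary.Unique.Propositional using (Unique)
import Data.List.Relation.Unary.Unique.Propositional.Properties as Unique
open import Data.List.Relation.Binary.Permutation.Propositional as ↭
  using (_↭_; ↭-refl; ↭-sym; ↭-trans; prep)
open import Data.List.Relation.Binary.Permutation.Propositional.Properties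
  using (drop-∷; shift; ++⁺ˡ; ↭-empty-inv; ↭-length; ∈-resp-↭)
open import Data.Nat
open import Data.Nat.Combinatorics using (_C_; nCk≡n!/k![n-k]!; k![n∸k]!∣n!; k>n⇒nCk≡0; nCk+nC[k+1]≡[n+1]C[k+1])
open import Data.Nat.DivMod using (m/n*n≡m)
open import Data.Nat.ListAction using (sum)
open import Data.Nat.Properties
open import Algebra.Properties.CommutativeSemigroup +-commutativeSemigroup using (x∙yz≈y∙xz)
open import Data.Nat.Tactic.RingSolver using (solve-∀)
open import Data.Product as Product using (_×_; _,_; proj₁; proj₂; ∃-syntax)
open import Data.Sum as Sum using (_⊎_; inj₁; inj₂)
open import Data.Unit using (tt)
open import Data.Vec using (Vec; []; _∷_; toList; _∷ʳ_; initLast)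
import Data.Vec.Properties as Vec
open import Function using (_∘_; case_of_)
open import Function.Bundles using (_⇔_; mk⇔)
open import Relation.Binary.PropositionalEquality hiding ([_])
open import Relation.Nullary using (¬_; does; yes; no; contradiction)
open import Relation.Nullary.Decidable using (dec-true; dec-false)
open import Relation.Unary using (Decidable)

bit : Bool → ℕ
bit b = if b then 1 else 0

private variable A B : Set

count : (A → Bool) → List A → ℕ
count f []       = 0
count f (x ∷ xs) = bit (f x) + count f xs

count-++ : ∀ (f : A → Bool) xs ys → count f (xs ++ ys) ≡ count f xs + count f ys
count-++ f []       ys = refl
count-++ f (x ∷ xs) ys =
  trans (cong (bit (f x) +_) (count-++ f xs ys)) (sym (+-assoc (bit (f x)) _ _))

count-map : ∀ (f : B → Bool) (g : A → B) xs → count f (map g xs) ≡ count (f ∘ g) xs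
count-map f g []       = refl
count-map f g (x ∷ xs) = cong (bit (f (g x)) +_) (count-map f g xs)

count-cong : ∀ {f g : A → Bool} xs → (∀ {x} → x ∈ xs → f x ≡ g x) → count f xs ≡ count g xs
count-cong []       f≡g = refl
count-cong (x ∷ xs) f≡g = cong₂ (λ b c → bit b + c) (f≡g (here refl)) (count-cong xs (f≡g ∘ there))

count-false : ∀ {f : A → Bool} xs → (∀ {x} → x ∈ xs → f x ≡ false) → count f xs ≡ 0
count-false []       _   = refl
count-false (x ∷ xs) f≡0 rewrite f≡0 (here refl) = count-false xs (f≡0 ∘ there)

count-true : ∀ {f : A → Bool} xs → (∀ {x} → x ∈ xs → f x ≡ true) → count f xs ≡ length xs
count-true []       _   = refl
count-true (x ∷ xs) f≡1 rewrite f≡1 (here refl) = cong suc (count-true xs (f≡1 ∘ there))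

count+count-not : ∀ (f : A → Bool) xs → count f xs + count (not ∘ f) xs ≡ length xs
count+count-not f []       = refl
count+count-not f (x ∷ xs) with f x
... | true  = cong suc (count+count-not f xs)
... | false = trans (+-suc (count f xs) _) (cong suc (count+count-not f xs))

count-↭ : ∀ (f : A → Bool) {xs ys} → xs ↭ ys → count f xs ≡ count f ys
count-↭ f ↭.refl = refl
count-↭ f (prep x xs↭ys) = cong (bit (f x) +_) (count-↭ f xs↭ys)
count-↭ f {x ∷ y ∷ xs} (↭.swap x y xs↭ys) = begin
  bit (f x) + (bit (f y) + count f xs) ≡⟨ sym (+-assoc (bit (f x)) _ _) ⟩
  bit (f x) + bit (f y) + count f xs   ≡⟨ cong (_+ count f xs) (+-comm (bit (f x)) _) ⟩
  bit (f y) + bit (f x) + count f xs   ≡⟨ +-assoc (bit (f y)) _ _ ⟩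
  bit (f y) + (bit (f x) + count f xs) ≡⟨ cong (λ c → bit (f y) + (bit (f x) + c)) (count-↭ f xs↭ys) ⟩
  _ ∎
  where open ≡-Reasoning
count-↭ f (↭.trans p q) = trans (count-↭ f p) (count-↭ f q)

length-filter : ∀ {P : A → Set} (P? : Decidable P) xs → length (filter P? xs) ≡ count (does ∘ P?) xs
length-filter P? []       = refl
length-filter P? (x ∷ xs) with does (P? x)
... | true  = cong suc (length-filter P? xs)
... | false = length-filter P? xs

range : ℕ → ℕ → List ℕ
range a zero    = []
range a (suc c) = a ∷ range (suc a) c

range-++ : ∀ a b c → range a (b + c) ≡ range a b ++ range (a + b) c
range-++ a zero    c = cong (λ a′ → range a′ c) (sym (+-identityʳ a))
range-++ a (suc b) c =
  cong (a ∷_) (trans (range-++ (suc a) b c) (cong (λ a′ → range (suc a) b ++ range a′ c) (sym (+-suc a b))))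

range-∷ʳ : ∀ a c → range a (suc c) ≡ range a c ++ (a + c) ∷ []
range-∷ʳ a c = trans (cong (range a) (+-comm 1 c)) (range-++ a c 1)

length-range : ∀ a c → length (range a c) ≡ c
length-range a zero    = refl
length-range a (suc c) = cong suc (length-range (suc a) c)

∈-range⁻ : ∀ {i} a c → i ∈ range a c → a ≤ i × i < a + c
∈-range⁻ a (suc c) (here refl) = ≤-refl , m<m+n a (s≤s z≤n)
∈-range⁻ {i} a (suc c) (there i∈) with ∈-range⁻ (suc a) c i∈
... | a<i , i<a+c = <⇒≤ a<i , subst (i <_) (sym (+-suc a c)) i<a+c

range-unique : ∀ a c → Unique (range a c)
range-unique a zero    = []
range-unique a (suc c) =
  All.tabulate (λ i∈ a≡i → <-irrefl a≡i (proj₁ (∈-range⁻ (suc a) c i∈))) ∷ range-unique (suc a) c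

count-range-suc : ∀ (f : ℕ → Bool) a c → count f (range (suc a) c) ≡ count (f ∘ suc) (range a c)
count-range-suc f a zero    = refl
count-range-suc f a (suc c) = cong (bit (f (suc a)) +_) (count-range-suc f (suc a) c)

count-range-true : ∀ {f : ℕ → Bool} a c → (∀ {i} → a ≤ i → i < a + c → f i ≡ true) →
                   count f (range a c) ≡ c
count-range-true a c f≡1 =
  trans (count-true (range a c) (λ i∈ → let a≤i , i< = ∈-range⁻ a c i∈ in f≡1 a≤i i<)) (length-range a c)

count-range-false : ∀ {f : ℕ → Bool} a c → (∀ {i} → a ≤ i → i < a + c → f i ≡ false) →
                    count f (range a c) ≡ 0
count-range-false a c f≡0 =
  count-false (range a c) (λ i∈ → let a≤i , i< = ∈-range⁻ a c i∈ in f≡0 a≤i i<)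

applyUpTo≡range : ∀ (f : ℕ → ℕ) a c → (∀ i → f i ≡ a + i) → applyUpTo f c ≡ range a c
applyUpTo≡range f a zero    f≗a+ = refl
applyUpTo≡range f a (suc c) f≗a+ =
  cong₂ _∷_ (trans (f≗a+ 0) (+-identityʳ a))
            (applyUpTo≡range (f ∘ suc) (suc a) c (λ i → trans (f≗a+ (suc i)) (+-suc a i)))

map-suc-upTo : ∀ n → map suc (upTo n) ≡ range 1 n
map-suc-upTo n = trans (map-applyUpTo (λ i → i) suc n) (applyUpTo≡range suc 1 n (λ i → refl))

-- Arrangements of a list

picks : List A → List (A × List A)
picks []       = []
picks (x ∷ xs) = (x , xs) ∷ map (λ (y , r) → y , x ∷ r) (picks xs)

∈-picks⁻ : ∀ {L y r} → (y , r) ∈ picks {A} L → L ↭ y ∷ r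
∈-picks⁻ {L = x ∷ xs} (here refl) = ↭-refl
∈-picks⁻ {L = x ∷ xs} (there yr∈) with (y , r) , yr∈′ , refl ← ∈-map⁻ _ yr∈ =
  ↭-trans (prep x (∈-picks⁻ yr∈′)) (↭.swap x y ↭-refl)

∈-picks⁺ : ∀ {L y} → y ∈ L → ∃[ r ] (y , r) ∈ picks {A} L
∈-picks⁺ {L = x ∷ xs} (here refl) = xs , here refl
∈-picks⁺ {L = x ∷ xs} (there y∈) with r , yr∈ ← ∈-picks⁺ y∈ = x ∷ r , there (∈-map⁺ _ yr∈)

length-picks-rest : ∀ {L y r} → (y , r) ∈ picks {A} L → length L ≡ suc (length r)
length-picks-rest yr∈ = ↭-length (∈-picks⁻ yr∈)

map-proj₁-picks : ∀ L → map proj₁ (picks {A} L) ≡ L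
map-proj₁-picks []       = refl
map-proj₁-picks (x ∷ xs) = cong (x ∷_) (trans (sym (map-∘ (picks xs))) (map-proj₁-picks xs))

picks-unique : ∀ {L y r} → Unique {A = A} L → (y , r) ∈ picks L → Unique r
picks-unique {L = x ∷ xs} (_ ∷ xs!) (here refl) = xs!
picks-unique {L = x ∷ xs} (x∉xs ∷ xs!) (there yr∈) with (y , r) , yr∈′ , refl ← ∈-map⁻ _ yr∈ =
  All.tabulate (λ z∈r → All.lookup x∉xs (∈-resp-↭ (↭-sym (∈-picks⁻ yr∈′)) (there z∈r)))
  ∷ picks-unique xs! yr∈′

mutual
  arrangements : (k : ℕ) → List A → List (Vec A k)
  arrangements zero    []      = [] ∷ []
  arrangements zero    (_ ∷ _) = []
  arrangements (suc k) L       = arrangementsWithHeads k (picks L)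

  arrangementsWithHeads : (k : ℕ) → List (A × List A) → List (Vec A (suc k))
  arrangementsWithHeads k []            = []
  arrangementsWithHeads k ((y , r) ∷ S) = map (y ∷_) (arrangements k r) ++ arrangementsWithHeads k S

∈-arrangementsWithHeads⁻ : ∀ {k} S {w} → w ∈ arrangementsWithHeads {A} k S →
  ∃[ y ] ∃[ r ] ∃[ w′ ] (y , r) ∈ S × w′ ∈ arrangements k r × w ≡ y ∷ w′
∈-arrangementsWithHeads⁻ ((y , r) ∷ S) w∈ with ∈-++⁻ (map (y ∷_) _) w∈
... | inj₁ w∈ʰ with w′ , w′∈ , refl ← ∈-map⁻ (y ∷_) w∈ʰ = y , r , w′ , here refl , w′∈ , refl
... | inj₂ w∈ᵗ with y′ , r′ , w′ , yr∈ , w′∈ , refl ← ∈-arrangementsWithHeads⁻ S w∈ᵗ =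
  y′ , r′ , w′ , there yr∈ , w′∈ , refl

∈-arrangementsWithHeads⁺ : ∀ {k} S {y r w} → (y , r) ∈ S → w ∈ arrangements {A} k r →
  y ∷ w ∈ arrangementsWithHeads k S
∈-arrangementsWithHeads⁺ (_ ∷ S) (here refl) w∈ = ∈-++⁺ˡ (∈-map⁺ _ w∈)
∈-arrangementsWithHeads⁺ ((y , r) ∷ S) (there yr∈) w∈ =
  ∈-++⁺ʳ (map (y ∷_) (arrangements _ r)) (∈-arrangementsWithHeads⁺ S yr∈ w∈)

∈-arrangements⁻ : ∀ k L {w} → w ∈ arrangements {A} k L → toList w ↭ L
∈-arrangements⁻ zero    []      (here refl) = ↭-refl
∈-arrangements⁻ (suc k) L w∈ with y , r , w′ , yr∈ , w′∈ , refl ← ∈-arrangementsWithHeads⁻ (picks L) w∈ =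
  ↭-trans (prep y (∈-arrangements⁻ k r w′∈)) (↭-sym (∈-picks⁻ yr∈))

∈-arrangements⁺ : ∀ k L (w : Vec A k) → toList w ↭ L → w ∈ arrangements k L
∈-arrangements⁺ zero    L []      w↭L rewrite ↭-empty-inv (↭-sym w↭L) = here refl
∈-arrangements⁺ (suc k) L (y ∷ w) w↭L with r , yr∈ ← ∈-picks⁺ (∈-resp-↭ w↭L (here refl)) =
  ∈-arrangementsWithHeads⁺ (picks L) yr∈ (∈-arrangements⁺ k r w (drop-∷ (↭-trans w↭L (∈-picks⁻ yr∈))))

arrangementsWithHeads-unique : ∀ {k} S → Unique (map proj₁ S) →
  (∀ {y r} → (y , r) ∈ S → Unique (arrangements {A} k r)) → Unique (arrangementsWithHeads k S)
arrangementsWithHeads-unique []            _                  _    = []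
arrangementsWithHeads-unique ((y , r) ∷ S) (y∉ ∷ heads!) arrs! =
  Unique.++⁺ (Unique.map⁺ Vec.∷-injectiveʳ (arrs! (here refl)))
             (arrangementsWithHeads-unique S heads! (arrs! ∘ there))
             disjoint
  where
  disjoint : ∀ {v} → ¬ (v ∈ map (y ∷_) _ × v ∈ arrangementsWithHeads _ S)
  disjoint (v∈ʰ , v∈ᵗ) with _ , _ , refl ← ∈-map⁻ (y ∷_) v∈ʰ
                       with y′ , _ , _ , yr∈ , _ , refl ← ∈-arrangementsWithHeads⁻ S v∈ᵗ =
    All.lookup y∉ (∈-map⁺ proj₁ yr∈) refl

arrangements-unique : ∀ k L → Unique {A = A} L → Unique (arrangements k L)
arrangements-unique zero    []      _  = All.[] ∷ []
arrangements-unique zero    (_ ∷ _) _  = []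
arrangements-unique (suc k) L       L! =
  arrangementsWithHeads-unique (picks L) (subst Unique (sym (map-proj₁-picks L)) L!)
    (λ yr∈ → arrangements-unique k _ (picks-unique L! yr∈))

length-picks : ∀ L → length (picks {A} L) ≡ length L
length-picks L = trans (sym (length-map proj₁ (picks L))) (cong length (map-proj₁-picks L))

length-arrangements : ∀ k L → length {A = A} L ≡ k → length (arrangements k L) ≡ k !
length-arrangements zero    []      _   = refl
length-arrangements (suc k) L       len =
  trans (length-with-heads (picks L) each) (cong (_* k !) (trans (length-picks L) len))
  where
  each : ∀ {y r} → (y , r) ∈ picks L → length (arrangements k r) ≡ k !
  each yr∈ = length-arrangements k _ (suc-injective (trans (sym (length-picks-rest yr∈)) len))
  length-with-heads : ∀ S → (∀ {y r} → (y , r) ∈ S → length (arrangements k r) ≡ k !) →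
    length (arrangementsWithHeads k S) ≡ length S * k !
  length-with-heads []            _    = refl
  length-with-heads ((y , r) ∷ S) each′ = begin
    length (map (y ∷_) (arrangements k r) ++ arrangementsWithHeads k S)
      ≡⟨ length-++ (map (y ∷_) (arrangements k r)) ⟩
    length (map (y ∷_) (arrangements k r)) + length (arrangementsWithHeads k S)
      ≡⟨ cong₂ _+_ (trans (length-map (y ∷_) (arrangements k r)) (each′ (here refl)))
                   (length-with-heads S (each′ ∘ there)) ⟩
    k ! + length S * k ! ∎
    where open ≡-Reasoning

sum-map-cong : ∀ {f g : A → ℕ} xs → (∀ {x} → x ∈ xs → f x ≡ g x) → sum (map f xs) ≡ sum (map g xs)
sum-map-cong xs f≡g = cong sum (map-cong-local (All.tabulate f≡g))

sum-map-if : ∀ (f : A → Bool) c₁ c₂ xs →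
  sum (map (λ x → if f x then c₁ else c₂) xs) ≡ count f xs * c₁ + count (not ∘ f) xs * c₂
sum-map-if f c₁ c₂ []       = refl
sum-map-if f c₁ c₂ (x ∷ xs) with f x
... | true  = trans (cong (c₁ +_) (sum-map-if f c₁ c₂ xs)) (sym (+-assoc c₁ _ _))
... | false = trans (cong (c₂ +_) (sum-map-if f c₁ c₂ xs)) (x∙yz≈y∙xz c₂ (count f xs * c₁) _)

sum-picks-if : ∀ (f : A → Bool) c₁ c₂ L →
  sum (map (λ (y , _) → if f y then c₁ else c₂) (picks L)) ≡ count f L * c₁ + count (not ∘ f) L * c₂
sum-picks-if f c₁ c₂ L =
  trans (cong sum (map-∘ (picks L)))
        (trans (cong (λ ys → sum (map (λ y → if f y then c₁ else c₂) ys)) (map-proj₁-picks L))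
               (sum-map-if f c₁ c₂ L))

count-arrangementsWithHeads : ∀ {k} (F : Vec A (suc k) → Bool) S →
  count F (arrangementsWithHeads k S) ≡ sum (map (λ (y , r) → count (F ∘ (y ∷_)) (arrangements k r)) S)
count-arrangementsWithHeads F []            = refl
count-arrangementsWithHeads F ((y , r) ∷ S) =
  trans (count-++ F (map (y ∷_) (arrangements _ r)) _)
        (cong₂ _+_ (count-map F (y ∷_) (arrangements _ r)) (count-arrangementsWithHeads F S))

count-picks-rest : ∀ (f : A → Bool) {L y r} → (y , r) ∈ picks L →
                   ∀ {b} → f y ≡ b → count f r ≡ count f L ∸ bit b
count-picks-rest f {y = y} {r} yr∈ refl =
  sym (trans (cong (_∸ bit (f y)) (count-↭ f (∈-picks⁻ yr∈))) (m+n∸m≡n (bit (f y)) (count f r)))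

-- The number of arrangements of a marked and b unmarked items with exactly j marked ones among
-- the first m positions, by cases on the first entry.
hitCount : ℕ → ℕ → ℕ → ℕ → ℕ
hitCount a b zero    zero    = (a + b) !
hitCount a b zero    (suc j) = 0
hitCount a b (suc m) zero    = b * hitCount a (b ∸ 1) m zero
hitCount a b (suc m) (suc j) = a * hitCount (a ∸ 1) b m j + b * hitCount a (b ∸ 1) m (suc j)

countPrefix : ∀ {k} → (A → Bool) → ℕ → Vec A k → ℕ
countPrefix f m w = count f (take m (toList w))

count-hits-empty-prefix : ∀ (f : A → Bool) k L j → length L ≡ k →
  count (λ w → countPrefix f 0 w ≡ᵇ j) (arrangements k L) ≡ hitCount (count f L) (count (not ∘ f) L) 0 j
count-hits-empty-prefix f k L zero len = begin
  count (λ _ → true) (arrangements k L) ≡⟨ count-true (arrangements k L) (λ _ → refl) ⟩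
  length (arrangements k L)             ≡⟨ length-arrangements k L len ⟩
  k !                                   ≡⟨ cong _! (sym (trans (count+count-not f L) len)) ⟩
  (count f L + count (not ∘ f) L) !     ∎
  where open ≡-Reasoning
count-hits-empty-prefix f k L (suc j) _ = count-false (arrangements k L) (λ _ → refl)

count-hits : ∀ (f : A → Bool) k L m j → length L ≡ k → m ≤ k →
  count (λ w → countPrefix f m w ≡ᵇ j) (arrangements k L) ≡ hitCount (count f L) (count (not ∘ f) L) m j
count-hits f k L zero j len _ = count-hits-empty-prefix f k L j len
count-hits f (suc k) L (suc m) j len (s≤s m≤k) = begin
  count F (arrangements (suc k) L)
    ≡⟨ count-arrangementsWithHeads F (picks L) ⟩
  sum (map (λ (y , r) → count (F ∘ (y ∷_)) (arrangements k r)) (picks L))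
    ≡⟨ sum-map-cong (picks L) by-head ⟩
  sum (map (λ (y , _) → if f y then markedHead j else hitCount a (b ∸ 1) m j) (picks L))
    ≡⟨ sum-picks-if f _ _ L ⟩
  a * markedHead j + b * hitCount a (b ∸ 1) m j
    ≡⟨ recombine j ⟩
  hitCount a b (suc m) j ∎
  where
  open ≡-Reasoning
  a = count f L
  b = count (not ∘ f) L
  F : Vec _ (suc k) → Bool
  F w = countPrefix f (suc m) w ≡ᵇ j
  markedHead : ℕ → ℕ
  markedHead zero     = 0
  markedHead (suc j′) = hitCount (a ∸ 1) b m j′
  recombine : ∀ j → a * markedHead j + b * hitCount a (b ∸ 1) m j ≡ hitCount a b (suc m) j
  recombine zero    = cong (_+ b * hitCount a (b ∸ 1) m zero) (*-zeroʳ a)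
  recombine (suc j) = refl
  length-rest : ∀ {y r} → (y , r) ∈ picks L → length r ≡ k
  length-rest yr∈ = suc-injective (trans (sym (length-picks-rest yr∈)) len)
  by-head : ∀ {s} → s ∈ picks L → count (F ∘ (proj₁ s ∷_)) (arrangements k (proj₂ s))
                                 ≡ (if f (proj₁ s) then markedHead j else hitCount a (b ∸ 1) m j)
  by-head {y , r} yr∈ with f y in fy
  ... | true  = marked j
    where
    marked : ∀ j → count (λ w → suc (countPrefix f m w) ≡ᵇ j) (arrangements k r) ≡ markedHead j
    marked zero     = count-false (arrangements k r) (λ _ → refl)
    marked (suc j′) = trans (count-hits f k r m j′ (length-rest yr∈) m≤k)
      (cong₂ (λ a′ b′ → hitCount a′ b′ m j′) (count-picks-rest f yr∈ fy) (count-picks-rest (not ∘ f) yr∈ (cong not fy)))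
  ... | false = trans (count-hits f k r m j (length-rest yr∈) m≤k)
    (cong₂ (λ a′ b′ → hitCount a′ b′ m j) (count-picks-rest f yr∈ fy) (count-picks-rest (not ∘ f) yr∈ (cong not fy)))

-- The hypergeometric closed form

nCk*[k!*[n∸k]!]≡n! : ∀ {n k} → k ≤ n → (n C k) * (k ! * (n ∸ k) !) ≡ n !
nCk*[k!*[n∸k]!]≡n! {n} {k} k≤n =
  trans (cong (_* (k ! * (n ∸ k) !)) (nCk≡n!/k![n-k]! k≤n))
        (m/n*n≡m {{k !* (n ∸ k) !≢0}} (k![n∸k]!∣n! k≤n))

module _ {k r N j : ℕ} where

  hypNum-≤ : j ≤ k → hypNum k r N j ≡ (r C j) * ((N ∸ r) C (k ∸ j))
  hypNum-≤ j≤k with j ≤? k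
  ... | yes _   = refl
  ... | no  j≰k = contradiction j≤k j≰k

  hypNum-≰ : ¬ j ≤ k → hypNum k r N j ≡ 0
  hypNum-≰ j≰k with j ≤? k
  ... | yes j≤k = contradiction j≤k j≰k
  ... | no  _   = refl

  hypNum-rCj≡0 : r C j ≡ 0 → hypNum k r N j ≡ 0
  hypNum-rCj≡0 rCj≡0 with j ≤? k
  ... | yes _ = cong (_* ((N ∸ r) C (k ∸ j))) rCj≡0
  ... | no  _ = refl

-- hypNum a m (a + b) j = C(m, j) C(a+b-m, a-j) places the marked items; a! b! orders both kinds.
hypCount : ℕ → ℕ → ℕ → ℕ → ℕ
hypCount a b m j = hypNum a m (a + b) j * (a ! * b !)

hypCount-zero-zero : ∀ a b → hypCount a b 0 0 ≡ (a + b) !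
hypCount-zero-zero a b = begin
  hypNum a 0 (a + b) 0 * (a ! * b !)       ≡⟨ cong (_* (a ! * b !)) (*-identityˡ ((a + b) C a)) ⟩
  ((a + b) C a) * (a ! * b !)               ≡⟨ cong (λ c → ((a + b) C a) * (a ! * c !)) (sym (m+n∸m≡n a b)) ⟩
  ((a + b) C a) * (a ! * (a + b ∸ a) !)     ≡⟨ nCk*[k!*[n∸k]!]≡n! (m≤m+n a b) ⟩
  (a + b) !                                 ∎
  where open ≡-Reasoning

hypCount-zero-suc : ∀ a b j → hypCount a b 0 (suc j) ≡ 0
hypCount-zero-suc a b j = cong (_* (a ! * b !)) (hypNum-rCj≡0 {a} {0} {a + b} {suc j} refl)

hypCount-suc-zero : ∀ a b m → suc m ≤ a + b → hypCount a b (suc m) 0 ≡ b * hypCount a (b ∸ 1) m 0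
hypCount-suc-zero a zero m m<a+0 rewrite +-identityʳ a =
  cong (λ c → 1 * c * (a ! * 1)) (k>n⇒nCk≡0 (∸-monoʳ-< {o = 0} (s≤s z≤n) m<a+0))
hypCount-suc-zero a (suc b) m _ rewrite +-suc a b = rearrange (suc b) ((a + b ∸ m) C a) (a !) (b !)
  where
  rearrange : ∀ b′ X A B → 1 * X * (A * (b′ * B)) ≡ b′ * (1 * X * (A * B))
  rearrange = solve-∀

-- C(m, j+1) C(a-m, a-j) vanishes: either j+1 > m, or a-j < a-m.
pascal-prefix : ∀ m a j → m ≤ a → (suc m C suc j) * ((a ∸ m) C (a ∸ j)) ≡ (m C j) * ((a ∸ m) C (a ∸ j))
pascal-prefix m a j m≤a = begin
  (suc m C suc j) * Y              ≡⟨ cong (_* Y) (sym (nCk+nC[k+1]≡[n+1]C[k+1] m j)) ⟩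
  ((m C j) + (m C suc j)) * Y      ≡⟨ *-distribʳ-+ Y (m C j) (m C suc j) ⟩
  (m C j) * Y + (m C suc j) * Y    ≡⟨ cong ((m C j) * Y +_) vanishes ⟩
  (m C j) * Y + 0                  ≡⟨ +-identityʳ _ ⟩
  (m C j) * Y                      ∎
  where
  open ≡-Reasoning
  Y = (a ∸ m) C (a ∸ j)
  vanishes : (m C suc j) * Y ≡ 0
  vanishes with suc j ≤? m
  ... | yes j<m = trans (cong ((m C suc j) *_) (k>n⇒nCk≡0 (∸-monoʳ-< j<m m≤a))) (*-zeroʳ (m C suc j))
  ... | no  j≮m = cong (_* Y) (k>n⇒nCk≡0 (≰⇒> j≮m))

private
  hypCount-suc-suc-≰ : ∀ a b m j → ¬ j ≤ a →
    hypCount (suc a) b (suc m) (suc j) ≡ suc a * hypCount a b m j + b * hypCount (suc a) (b ∸ 1) m (suc j)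
  hypCount-suc-suc-≰ a b m j j≰a
    rewrite hypNum-≰ {suc a} {suc m} {suc a + b} {suc j} (j≰a ∘ s≤s⁻¹)
          | hypNum-≰ {a} {m} {a + b} {j} j≰a
          | hypNum-≰ {suc a} {m} {suc a + (b ∸ 1)} {suc j} (j≰a ∘ s≤s⁻¹)
          = sym (cong₂ _+_ (*-zeroʳ (suc a)) (*-zeroʳ b))

  hypCount-suc-suc-≤ : ∀ a b m j → j ≤ a → suc m ≤ suc a + b →
    hypCount (suc a) b (suc m) (suc j) ≡ suc a * hypCount a b m j + b * hypCount (suc a) (b ∸ 1) m (suc j)
  hypCount-suc-suc-≤ a zero m j j≤a m<a+0
    rewrite hypNum-≤ {suc a} {suc m} {suc a + 0} {suc j} (s≤s j≤a)
          | hypNum-≤ {a} {m} {a + 0} {j} j≤a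
          | +-identityʳ a
          = trans (cong (_* (suc a ! * 1)) (pascal-prefix m a j (s≤s⁻¹ m<a+0)))
                  (rearrange a (m C j) ((a ∸ m) C (a ∸ j)) (a !))
    where
    rearrange : ∀ a x Y A → x * Y * ((A + a * A) * 1) ≡ (1 + a) * (x * Y * (A * 1)) + 0
    rearrange = solve-∀
  hypCount-suc-suc-≤ a (suc b) m j j≤a _
    rewrite hypNum-≤ {suc a} {suc m} {suc a + suc b} {suc j} (s≤s j≤a)
          | hypNum-≤ {a} {m} {a + suc b} {j} j≤a
          | hypNum-≤ {suc a} {m} {suc a + b} {suc j} (s≤s j≤a)
          | +-suc a b
          = trans (cong (λ c → c * Y * (suc a ! * suc b !)) (sym (nCk+nC[k+1]≡[n+1]C[k+1] m j)))
                  (rearrange a b (m C j) (m C suc j) Y (a !) (b !))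
    where
    Y = (suc (a + b) ∸ m) C (a ∸ j)
    rearrange : ∀ a b x y Y A B →
      (x + y) * Y * ((A + a * A) * (B + b * B))
        ≡ (1 + a) * (x * Y * (A * (B + b * B))) + (1 + b) * (y * Y * ((A + a * A) * B))
    rearrange = solve-∀

hypCount-suc-suc : ∀ a b m j → suc m ≤ a + b →
  hypCount a b (suc m) (suc j) ≡ a * hypCount (a ∸ 1) b m j + b * hypCount a (b ∸ 1) m (suc j)
hypCount-suc-suc zero    b m j _   = sym (*-zeroʳ b)
hypCount-suc-suc (suc a) b m j m<N = case j ≤? a of λ where
  (yes j≤a) → hypCount-suc-suc-≤ a b m j j≤a m<N
  (no  j≰a) → hypCount-suc-suc-≰ a b m j j≰a

private
  m<a+b⇒m≤[a∸1]+b : ∀ {m} a b → suc m ≤ a + b → m ≤ (a ∸ 1) + b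
  m<a+b⇒m≤[a∸1]+b zero    b m<b   = <⇒≤ m<b
  m<a+b⇒m≤[a∸1]+b (suc a) b m<a+b = s≤s⁻¹ m<a+b

  m<a+b⇒m≤a+[b∸1] : ∀ {m} a b → suc m ≤ a + b → m ≤ a + (b ∸ 1)
  m<a+b⇒m≤a+[b∸1] a zero    m<a+0 = <⇒≤ m<a+0
  m<a+b⇒m≤a+[b∸1] {m} a (suc b) m<a+b = s≤s⁻¹ (subst (suc m ≤_) (+-suc a b) m<a+b)

hitCount≡hypCount : ∀ a b m j → m ≤ a + b → hitCount a b m j ≡ hypCount a b m j
hitCount≡hypCount a b zero    zero    _   = sym (hypCount-zero-zero a b)
hitCount≡hypCount a b zero    (suc j) _   = sym (hypCount-zero-suc a b j)
hitCount≡hypCount a b (suc m) zero    m<N =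
  trans (cong (b *_) (hitCount≡hypCount a (b ∸ 1) m zero (m<a+b⇒m≤a+[b∸1] a b m<N)))
        (sym (hypCount-suc-zero a b m m<N))
hitCount≡hypCount a b (suc m) (suc j) m<N =
  trans (cong₂ _+_ (cong (a *_) (hitCount≡hypCount (a ∸ 1) b m j (m<a+b⇒m≤[a∸1]+b a b m<N)))
                   (cong (b *_) (hitCount≡hypCount a (b ∸ 1) m (suc j) (m<a+b⇒m≤a+[b∸1] a b m<N))))
        (sym (hypCount-suc-suc a b m j m<N))

-- The partitioning step

private
  fromTrue : ∀ {b} → b ≡ true → T b
  fromTrue refl = tt

  fromFalse : ∀ {b} → b ≡ false → ¬ T b
  fromFalse refl ()

  ≤ᵇ-true : ∀ m n → (m ≤ᵇ n) ≡ true → m ≤ n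
  ≤ᵇ-true m n eq = ≤ᵇ⇒≤ m n (fromTrue eq)

  ≤ᵇ-false : ∀ m n → (m ≤ᵇ n) ≡ false → n < m
  ≤ᵇ-false m n eq = ≰⇒> (λ m≤n → fromFalse eq (≤⇒≤ᵇ m≤n))

  <ᵇ-true : ∀ m n → (m <ᵇ n) ≡ true → m < n
  <ᵇ-true m n eq = <ᵇ⇒< m n (fromTrue eq)

swap-other : ∀ A {i j x} → x ≢ i → x ≢ j → swap A i j x ≡ A x
swap-other A {i} {j} {x} x≢i x≢j rewrite dec-false (x ≟ i) x≢i | dec-false (x ≟ j) x≢j = refl

-- Scanning an initial array A₀ with pivot values p and q: n₁ = n - 1 is the last position scanned
-- and iF the fuel of the inner loop.
module Partition (A₀ : Array) (n₁ iF p q : ℕ) where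

  large : ℕ → Bool
  large i = q <ᵇ A₀ i

  largeIn : ℕ → ℕ → ℕ
  largeIn a c = count large (range a c)

  largeLeft largeRight : ℕ → ℕ
  largeLeft  k = largeIn 2 (k ∸ 2)
  largeRight g = largeIn (suc g) (n₁ ∸ g)

  largeLeft-suc : ∀ k → 2 ≤ k → largeLeft (suc k) ≡ largeLeft k + bit (large k)
  largeLeft-suc (suc (suc k)) (s≤s (s≤s _)) =
    trans (cong (count large) (range-∷ʳ 2 k))
          (trans (count-++ large (range 2 k) _) (cong (largeLeft (2 + k) +_) (+-identityʳ _)))

  largeRight-pred : ∀ g → suc g ≤ n₁ → largeRight g ≡ bit (large (suc g)) + largeRight (suc g)
  largeRight-pred g g<n₁ rewrite +-∸-assoc 1 g<n₁ = refl

  largeLeft+largeRight : ∀ g → 1 ≤ g → g ≤ n₁ → largeLeft (suc g) + largeRight g ≡ largeIn 2 (n₁ ∸ 1)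
  largeLeft+largeRight (suc g) _ g<n₁ =
    trans (sym (count-++ large (range 2 g) _))
          (cong (count large) (trans (sym (range-++ 2 g _)) (cong (range 2) g+[n₁∸1+g]≡n₁∸1)))
    where
    g+[n₁∸1+g]≡n₁∸1 : g + (n₁ ∸ suc g) ≡ n₁ ∸ 1
    g+[n₁∸1+g]≡n₁∸1 =
      trans (cong (g +_) (sym (∸-+-assoc n₁ 1 g))) (m+[n∸m]≡n (suc[m]≤n⇒m≤pred[n] g<n₁))

  Balanced : ℕ → ℕ → Set
  Balanced k g = g + largeLeft k + largeRight g ≡ n₁

  Untouched : Array → ℕ → ℕ → Set
  Untouched A k g = ∀ i → k ≤ i → i ≤ g → A i ≡ A₀ i

  Untouched-narrow : ∀ {A k g k′ g′} → k ≤ k′ → g′ ≤ g → Untouched A k g → Untouched A k′ g′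
  Untouched-narrow k≤k′ g′≤g eq i k′≤i i≤g′ = eq i (≤-trans k≤k′ k′≤i) (≤-trans i≤g′ g′≤g)

  Untouched-swap : ∀ {A k g i j} → i < k ⊎ g < i → j < k ⊎ g < j → Untouched A k g → Untouched (swap A i j) k g
  Untouched-swap {A} i∉ j∉ eq x k≤x x≤g = trans (swap-other A (outside i∉) (outside j∉)) (eq x k≤x x≤g)
    where
    outside : ∀ {i} → i < _ ⊎ _ < i → x ≢ i
    outside (inj₁ i<k) refl = <⇒≱ i<k k≤x
    outside (inj₂ g<i) refl = <⇒≱ g<i x≤g

  record InnerStop (k g g′ : ℕ) : Set where
    field
      k≤g′       : k ≤ g′
      g′≤g       : g′ ≤ g
      skipsLarge : g′ + largeRight g′ ≡ g + largeRight g
      stopsAt    : g′ ≡ k ⊎ (k < g′ × large g′ ≡ false)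

  innerLoop-stop : ∀ fuel A k g → k ≤ g → g ≤ fuel → g ≤ n₁ → Untouched A k g →
                   InnerStop k g (innerLoop fuel A q k g)
  innerLoop-stop zero A k .zero z≤n z≤n _ _ =
    record { k≤g′ = z≤n ; g′≤g = z≤n ; skipsLarge = refl ; stopsAt = inj₁ refl }
  innerLoop-stop (suc fuel) A k g k≤g g≤fuel g≤n₁ eq with q <ᵇ A g in q<Ag | k <ᵇ g in k<ᵇg
  ... | true | true with suc g₀ ← g =
    record { k≤g′ = k≤g′ ; g′≤g = ≤-trans g′≤g (n≤1+n g₀)
           ; skipsLarge = trans skipsLarge (trans (cong (g₀ +_) right) (+-suc g₀ _)) ; stopsAt = stopsAt }
    where
    stop = innerLoop-stop fuel A k g₀ (s≤s⁻¹ (<ᵇ-true k _ k<ᵇg)) (s≤s⁻¹ g≤fuel)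
                          (≤-trans (n≤1+n g₀) g≤n₁) (Untouched-narrow ≤-refl (n≤1+n g₀) eq)
    open InnerStop stop
    right : largeRight g₀ ≡ 1 + largeRight (suc g₀)
    right = trans (largeRight-pred g₀ g≤n₁)
                  (cong (λ b → bit b + largeRight (suc g₀)) (trans (cong (q <ᵇ_) (sym (eq _ k≤g ≤-refl))) q<Ag))
  ... | false | _ = record { k≤g′ = k≤g ; g′≤g = ≤-refl ; skipsLarge = refl ; stopsAt = stop }
    where
    stop : g ≡ k ⊎ (k < g × large g ≡ false)
    stop with m≤n⇒m<n∨m≡n k≤g
    ... | inj₂ k≡g = inj₁ (sym k≡g)
    ... | inj₁ k<g = inj₂ (k<g , trans (cong (q <ᵇ_) (sym (eq g k≤g ≤-refl))) q<Ag)
  ... | true | false = record { k≤g′ = k≤g ; g′≤g = ≤-refl ; skipsLarge = refl ; stopsAt = stop }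
    where
    stop : g ≡ k ⊎ (k < g × large g ≡ false)
    stop with m≤n⇒m<n∨m≡n k≤g
    ... | inj₂ k≡g = inj₁ (sym k≡g)
    ... | inj₁ k<g = contradiction (<⇒<ᵇ k<g) (fromFalse k<ᵇg)

  record Outcome (k : ℕ) (out : List ℕ) : Set where
    field
      final     : ℕ
      k≤1+final : k ≤ suc final
      balanced  : Balanced (suc final) final
      visits    : out ≡ range k (suc final ∸ k)
                ⊎ (out ≡ range k (suc (suc final) ∸ k) × large (suc final) ≡ true)

  outcome-∷ : ∀ {k out} → Outcome (suc k) out → Outcome k (k ∷ out)
  outcome-∷ {k} o = record
    { final = final ; k≤1+final = k≤final+1 ; balanced = balanced
    ; visits = Sum.map (prepend (s≤s⁻¹ k≤1+final)) (Product.map₁ (prepend k≤final+1)) visits }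
    where
    open Outcome o
    k≤final+1 = ≤-trans (n≤1+n k) k≤1+final
    prepend : ∀ {out m} → k ≤ m → out ≡ range (suc k) (m ∸ k) → k ∷ out ≡ range k (suc m ∸ k)
    prepend k≤m eq = trans (cong (k ∷_) eq) (cong (range k) (sym (+-∸-assoc 1 k≤m)))

  outerLoop-exhausted : ∀ fuel A ℓ g k → g < k → outerLoop fuel iF A p q ℓ g k ≡ []
  outerLoop-exhausted zero       A ℓ g k g<k = refl
  outerLoop-exhausted (suc fuel) A ℓ g k g<k with k ≤ᵇ g in k≤ᵇg
  ... | false = refl
  ... | true  = contradiction (≤ᵇ-true k g k≤ᵇg) (<⇒≱ g<k)

  record Invariant (fuel ℓ g k : ℕ) : Set where
    field
      ℓ≤k        : ℓ ≤ k
      2≤k        : 2 ≤ k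
      k≤1+g      : k ≤ suc g
      g≤n₁       : g ≤ n₁
      enoughFuel : g + 2 ≤ k + fuel
      balancedₖ  : Balanced k g

  LoopSpec : ℕ → Set
  LoopSpec fuel = ∀ A ℓ g k → Invariant fuel ℓ g k → Untouched A k g → Outcome k (outerLoop fuel iF A p q ℓ g k)

  ¬large-at : ∀ {A k g} → Untouched A k g → k ≤ g → A k ≤ q → large k ≡ false
  ¬large-at {A} {k} untouched k≤g Aₖ≤q =
    dec-false (q <? A₀ k) (≤⇒≯ (subst (_≤ q) (untouched k ≤-refl k≤g) Aₖ≤q))

  Invariant-start : 1 ≤ n₁ → Invariant (suc n₁) 2 n₁ 2
  Invariant-start 1≤n₁ = record
    { ℓ≤k = ≤-refl ; 2≤k = ≤-refl ; k≤1+g = s≤s 1≤n₁ ; g≤n₁ = ≤-refl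
    ; enoughFuel = subst (_≤ 2 + suc n₁) (+-comm 2 n₁) (+-monoʳ-≤ 2 (n≤1+n n₁))
    ; balancedₖ = trans (cong (λ c → n₁ + 0 + largeIn (suc n₁) c) (n∸n≡0 n₁))
                        (trans (+-identityʳ _) (+-identityʳ n₁)) }

  final+largeIn≡n₁ : ∀ {out} (o : Outcome 2 out) → Outcome.final o + largeIn 2 (n₁ ∸ 1) ≡ n₁
  final+largeIn≡n₁ o = begin
    final + largeIn 2 (n₁ ∸ 1)
      ≡⟨ cong (final +_) (sym (largeLeft+largeRight final 1≤final final≤n₁)) ⟩
    final + (largeLeft (suc final) + largeRight final) ≡⟨ sym (+-assoc final _ _) ⟩
    final + largeLeft (suc final) + largeRight final   ≡⟨ balanced ⟩
    n₁                                                 ∎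
    where
    open ≡-Reasoning
    open Outcome o
    1≤final = s≤s⁻¹ k≤1+final
    final≤n₁ = ≤-trans (≤-trans (m≤m+n final _) (m≤m+n _ _)) (≤-reflexive balanced)

  module Scan (p≤q : p ≤ q) (q∉ : ∀ i → 2 ≤ i → i ≤ n₁ → A₀ i ≢ q) (n₁≤iF : n₁ ≤ iF) where

    private
      rebalance : ∀ x L R {g Rg} → suc x + R ≡ g + Rg → g + L + Rg ≡ n₁ → x + (L + 1) + R ≡ n₁
      rebalance x L R {g} {Rg} skips bal =
        trans (shuffle x L R) (trans (cong (_+ L) skips) (trans (shuffle′ g Rg L) bal))
        where
        shuffle : ∀ x L R → x + (L + 1) + R ≡ suc x + R + L
        shuffle = solve-∀
        shuffle′ : ∀ g Rg L → g + Rg + L ≡ g + L + Rg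
        shuffle′ = solve-∀

      ∸1< : ∀ {n} → 1 ≤ n → n ∸ 1 < n
      ∸1< (s≤s _) = ≤-refl

    advance : ∀ {f ℓ g k A′ ℓ′} → LoopSpec f → Invariant (suc f) ℓ g k → k ≤ g → large k ≡ false →
              ℓ′ ≤ suc k → Untouched A′ (suc k) g → Outcome k (k ∷ outerLoop f iF A′ p q ℓ′ g (suc k))
    advance {f} {g = g} {k} loop inv k≤g small ℓ′≤1+k untouched =
      outcome-∷ (loop _ _ g (suc k) inv′ untouched)
      where
      open Invariant inv
      left : largeLeft (suc k) ≡ largeLeft k
      left = trans (largeLeft-suc k 2≤k) (trans (cong (λ b → largeLeft k + bit b) small) (+-identityʳ _))
      inv′ : Invariant f _ g (suc k)
      inv′ = record
        { ℓ≤k = ℓ′≤1+k ; 2≤k = ≤-trans 2≤k (n≤1+n k) ; k≤1+g = s≤s k≤g ; g≤n₁ = g≤n₁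
        ; enoughFuel = subst (g + 2 ≤_) (+-suc k f) enoughFuel
        ; balancedₖ = trans (cong (λ L → g + L + largeRight g) left) balancedₖ }

    lastVisit : ∀ {g k} → Balanced (suc k) g → large (suc k) ≡ true →
                suc k + largeRight (suc k) ≡ g + largeRight g → suc k ≤ n₁ → Outcome (suc k) (suc k ∷ [])
    lastVisit {g} {k} bal big skips k<n₁ = record
      { final = k ; k≤1+final = ≤-refl
      ; balanced = trans (cong (k + largeLeft (suc k) +_) right) (trans (move k _ _) (rebalance k _ _ {g} skips bal))
      ; visits = inj₂ (cong (range (suc k)) (sym (m+n∸n≡m 1 k)) , big) }
      where
      right : largeRight k ≡ largeRight (suc k) + 1
      right = trans (largeRight-pred k k<n₁) (trans (cong (λ b → bit b + largeRight (suc k)) big) (+-comm 1 _))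
      move : ∀ k L R → k + L + (R + 1) ≡ k + (L + 1) + R
      move = solve-∀

    afterInner : ∀ {f ℓ g k g′ A′ ℓ′} → LoopSpec f → Invariant (suc f) ℓ g k → large k ≡ true →
                 InnerStop k g g′ → ℓ′ ≤ suc k → Untouched A′ (suc k) (g′ ∸ 1) →
                 Outcome k (k ∷ outerLoop f iF A′ p q ℓ′ (g′ ∸ 1) (suc k))
    afterInner {f} {ℓ} {g} {k} {g′} {A′} {ℓ′} loop inv big stop ℓ′≤1+k untouched
      with InnerStop.stopsAt stop | Invariant.2≤k inv
    ... | inj₁ refl | s≤s _ rewrite outerLoop-exhausted f A′ ℓ′ (g′ ∸ 1) (suc g′) (s≤s (m∸n≤m g′ 1)) =
      lastVisit {g} balancedₖ big skipsLarge (≤-trans g′≤g g≤n₁)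
      where
      open InnerStop stop
      open Invariant inv
    ... | inj₂ (s≤s {n = g₁} k≤g₁ , small) | _ = outcome-∷ (loop A′ ℓ′ g₁ (suc k) inv′ untouched)
      where
      open InnerStop stop
      open Invariant inv
      left : largeLeft (suc k) ≡ largeLeft k + 1
      left = trans (largeLeft-suc k 2≤k) (cong (λ b → largeLeft k + bit b) big)
      right : largeRight g₁ ≡ largeRight (suc g₁)
      right = trans (largeRight-pred g₁ (≤-trans g′≤g g≤n₁)) (cong (λ b → bit b + largeRight (suc g₁)) small)
      inv′ : Invariant f ℓ′ g₁ (suc k)
      inv′ = record
        { ℓ≤k = ℓ′≤1+k ; 2≤k = ≤-trans 2≤k (n≤1+n k) ; k≤1+g = s≤s k≤g₁
        ; g≤n₁ = ≤-trans (n≤1+n g₁) (≤-trans g′≤g g≤n₁)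
        ; enoughFuel = ≤-trans (+-monoˡ-≤ 2 (≤-trans (n≤1+n g₁) g′≤g))
                               (subst (g + 2 ≤_) (+-suc k f) enoughFuel)
        ; balancedₖ = trans (cong₂ (λ L R → g₁ + L + R) left right) (rebalance g₁ _ _ {g} skipsLarge balancedₖ) }

    large-at : ∀ {A k g} → Untouched A k g → 2 ≤ k → k ≤ g → g ≤ n₁ → q ≤ A k → large k ≡ true
    large-at {A} {k} untouched 2≤k k≤g g≤n₁ q≤Aₖ =
      dec-true (q <? A₀ k)
        (≤∧≢⇒< (subst (q ≤_) (untouched k ≤-refl k≤g) q≤Aₖ) (≢-sym (q∉ k 2≤k (≤-trans k≤g g≤n₁))))

    Untouched-swap-inner : ∀ {A k g g′} → 2 ≤ k → InnerStop k g g′ → Untouched A k g →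
                           Untouched (swap A k g′) (suc k) (g′ ∸ 1)
    Untouched-swap-inner {k = k} {g′ = g′} 2≤k stop untouched =
      Untouched-swap (inj₁ ≤-refl) (inj₂ (∸1< (≤-trans (≤-trans (s≤s z≤n) 2≤k) k≤g′)))
        (Untouched-narrow (n≤1+n k) (≤-trans (m∸n≤m g′ 1) g′≤g) untouched)
      where open InnerStop stop

    loop-step : ∀ f → LoopSpec f → LoopSpec (suc f)
    loop-step f loop A ℓ g k
              inv@record { ℓ≤k = ℓ≤k ; 2≤k = 2≤k ; k≤1+g = k≤1+g ; g≤n₁ = g≤n₁ ; balancedₖ = bal } untouched
      with k ≤ᵇ g in k≤ᵇg
    ... | false = record
      { final = g ; k≤1+final = k≤1+g ; balanced = subst (λ k → Balanced k g) k≡1+g bal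
      ; visits = inj₁ (cong (range k) (sym (m≤n⇒m∸n≡0 g<k))) }
      where
      g<k = ≤ᵇ-false k g k≤ᵇg
      k≡1+g = ≤-antisym k≤1+g g<k
    ... | true with A k <ᵇ p in Aₖ<ᵇp
    ...   | true  = advance loop inv k≤g (¬large-at untouched k≤g (<⇒≤ (<-≤-trans (<ᵇ-true _ _ Aₖ<ᵇp) p≤q)))
                      (s≤s ℓ≤k)
                      (Untouched-swap (inj₁ ≤-refl) (inj₁ (s≤s ℓ≤k)) (Untouched-narrow (n≤1+n k) ≤-refl untouched))
      where k≤g = ≤ᵇ-true k g k≤ᵇg
    ...   | false with q ≤ᵇ A k in q≤ᵇAₖ
    ...     | false = advance loop inv k≤g (¬large-at untouched k≤g (<⇒≤ (≤ᵇ-false _ _ q≤ᵇAₖ)))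
                        (≤-trans ℓ≤k (n≤1+n k)) (Untouched-narrow (n≤1+n k) ≤-refl untouched)
      where k≤g = ≤ᵇ-true k g k≤ᵇg
    ...     | true with innerLoop iF A q k g
                       | innerLoop-stop iF A k g (≤ᵇ-true k g k≤ᵇg) (≤-trans g≤n₁ n₁≤iF) g≤n₁ untouched
    ...       | g′ | stop with p ≤ᵇ A g′
    ...         | true  = afterInner loop inv big stop (≤-trans ℓ≤k (n≤1+n k))
                                     (Untouched-swap-inner 2≤k stop untouched)
      where big = large-at untouched 2≤k (≤ᵇ-true k g k≤ᵇg) g≤n₁ (≤ᵇ-true _ _ q≤ᵇAₖ)
    ...         | false = afterInner loop inv big stop (s≤s ℓ≤k)
                            (Untouched-swap (inj₁ ≤-refl) (inj₁ (s≤s ℓ≤k)) (Untouched-swap-inner 2≤k stop untouched))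
      where big = large-at untouched 2≤k (≤ᵇ-true k g k≤ᵇg) g≤n₁ (≤ᵇ-true _ _ q≤ᵇAₖ)

    loop : ∀ fuel → LoopSpec fuel
    loop zero    A ℓ g k inv _ = contradiction (≤-trans fuel k≤1+g) 1+n≰n
      where
      open Invariant inv
      fuel : suc (suc g) ≤ k
      fuel = subst₂ _≤_ (+-comm g 2) (+-identityʳ k) enoughFuel
    loop (suc f) = loop-step f (loop f)

    small-visited : 1 ≤ n₁ → ∀ m → m + largeIn 2 (n₁ ∸ 1) ≡ n₁ ∸ 1 →
                    length (filter (λ i → A₀ i <? p) (outerLoop (suc n₁) iF A₀ p q 2 n₁ 2))
                      ≡ count (λ i → A₀ i <ᵇ p) (range 2 m)
    small-visited 1≤n₁ m total =
      trans (length-filter (λ i → A₀ i <? p) (outerLoop (suc n₁) iF A₀ p q 2 n₁ 2)) (visited visits)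
      where
      small : ℕ → Bool
      small i = A₀ i <ᵇ p
      outcome = loop (suc n₁) A₀ 2 n₁ 2 (Invariant-start 1≤n₁) (λ _ _ _ → refl)
      open Outcome outcome
      final≡1+m : final ≡ suc m
      final≡1+m = +-cancelʳ-≡ (largeIn 2 (n₁ ∸ 1)) final (suc m)
        (trans (final+largeIn≡n₁ outcome) (trans (sym (m+[n∸m]≡n 1≤n₁)) (cong suc (sym total))))
      visited : ∀ {out} → out ≡ range 2 (suc final ∸ 2)
                          ⊎ (out ≡ range 2 (suc (suc final) ∸ 2) × large (suc final) ≡ true) →
                count small out ≡ count small (range 2 m)
      visited (inj₁ refl) rewrite final≡1+m = refl
      visited (inj₂ (refl , big)) rewrite final≡1+m =
        trans (cong (count small) (range-∷ʳ 2 m))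
              (trans (count-++ small (range 2 m) _)
                     (trans (cong (λ b → count small (range 2 m) + (bit b + 0))
                                  (dec-false (A₀ (2 + m) <? p) notSmall))
                            (+-identityʳ _)))
        where
        notSmall : ¬ A₀ (2 + m) < p
        notSmall Aₘ<p = <-asym (<-≤-trans Aₘ<p p≤q) (<ᵇ-true q _ big)

count-get : ∀ (f : ℕ → Bool) xs ys m → m ≤ length xs →
  count (λ i → f (get (xs ++ ys) (suc i))) (range 0 m) ≡ count f (take m xs)
count-get f xs       ys zero    _       = refl
count-get f (x ∷ xs) ys (suc m) (s≤s m≤) =
  cong (bit (f x) +_) (trans (count-range-suc _ 0 m) (count-get f xs ys m m≤))

get-∈ : ∀ xs ys i → i < length xs → get (xs ++ ys) (suc i) ∈ xs
get-∈ (x ∷ xs) ys zero    _         = here refl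
get-∈ (x ∷ xs) ys (suc i) (s≤s i<) = there (get-∈ xs ys i i<)

get-last : ∀ xs y → get (xs ++ [ y ]) (suc (length xs)) ≡ y
get-last []           y = refl
get-last (x ∷ [])     y = refl
get-last (x ∷ x′ ∷ xs) y = get-last (x′ ∷ xs) y

module _ {N : ℕ} (w : Vec ℕ N) (x y : ℕ) where

  frame : Vec ℕ (suc (suc N))
  frame = x ∷ (w ∷ʳ y)

  frame-last : arr frame (suc (suc N)) ≡ y
  frame-last rewrite Vec.toList-∷ʳ y w =
    subst (λ i → get (toList w ++ [ y ]) (suc i) ≡ y) (Vec.length-toList w) (get-last (toList w) y)

  frame-inner : ∀ i → i < N → arr frame (suc (suc i)) ∈ toList w
  frame-inner i i<N rewrite Vec.toList-∷ʳ y w =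
    get-∈ (toList w) [ y ] i (subst (i <_) (sym (Vec.length-toList w)) i<N)

  count-frame : ∀ (f : ℕ → Bool) m → m ≤ N → count (f ∘ arr frame) (range 2 m) ≡ count f (take m (toList w))
  count-frame f m m≤N
    rewrite count-range-suc (f ∘ arr frame) 1 m | count-range-suc (f ∘ arr frame ∘ suc) 0 m | Vec.toList-∷ʳ y w =
    count-get f (toList w) [ y ] m (subst (m ≤_) (sym (Vec.length-toList w)) m≤N)

  frame-↭ : toList frame ↭ x ∷ y ∷ toList w
  frame-↭ = prep x (begin
    toList (w ∷ʳ y)    ≡⟨ Vec.toList-∷ʳ y w ⟩
    toList w ++ [ y ]  ↭⟨ shift y (toList w) [] ⟩
    y ∷ toList w ++ [] ≡⟨ cong (y ∷_) (++-identityʳ (toList w)) ⟩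
    y ∷ toList w       ∎)
    where open ↭.PermutationReasoning

-- Conditioning on the pivots

-- The pivots are written p = p₀ + 1 < q = p + 1 + d ≤ n = q + e, so that n ∸ 2, p ∸ 1 and q ∸ 2
-- reduce to N = p₀ + d + e, p₀ and p₀ + d.
module Pivots (p₀ d e : ℕ) where

  p q n N : ℕ
  p = suc p₀
  q = suc p + d
  n = q + e
  N = p₀ + d + e

  below between above others : List ℕ
  below   = range 1 p₀
  between = range (suc p) d
  above   = range (suc q) e
  others  = below ++ between ++ above

  p<q : p < q
  p<q = m≤m+n (suc p) d

  others-↭ : p ∷ q ∷ others ↭ map suc (upTo n)
  others-↭ = ↭-sym (begin
    map suc (upTo n)                          ≡⟨ map-suc-upTo n ⟩
    range 1 n                                 ≡⟨ cong (range 1) (n≡ p₀ d e) ⟩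
    range 1 (p₀ + suc (d + suc e))            ≡⟨ range-++ 1 p₀ _ ⟩
    below ++ p ∷ range (suc p) (d + suc e)    ≡⟨ cong (λ xs → below ++ p ∷ xs) (range-++ (suc p) d (suc e)) ⟩
    below ++ p ∷ between ++ q ∷ above         ↭⟨ shift p below _ ⟩
    p ∷ below ++ between ++ q ∷ above         ↭⟨ prep p (++⁺ˡ below (shift q between above)) ⟩
    p ∷ below ++ q ∷ between ++ above         ↭⟨ prep p (shift q below _) ⟩
    p ∷ q ∷ others                            ∎)
    where
    open ↭.PermutationReasoning
    n≡ : ∀ p₀ d e → suc (suc p₀) + d + e ≡ p₀ + suc (d + suc e)
    n≡ = solve-∀

  ∈-others⁻ : ∀ {i} → i ∈ others → i < p ⊎ (p < i × i < q) ⊎ q < i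
  ∈-others⁻ i∈ with ∈-++⁻ below i∈
  ... | inj₁ i∈b = inj₁ (proj₂ (∈-range⁻ 1 p₀ i∈b))
  ... | inj₂ i∈r with ∈-++⁻ between i∈r
  ...   | inj₁ i∈m = inj₂ (inj₁ (∈-range⁻ (suc p) d i∈m))
  ...   | inj₂ i∈a = inj₂ (inj₂ (proj₁ (∈-range⁻ (suc q) e i∈a)))

  q∉others : q ∉ others
  q∉others q∈ with ∈-others⁻ q∈
  ... | inj₁ q<p              = <-asym q<p p<q
  ... | inj₂ (inj₁ (_ , q<q)) = <-irrefl refl q<q
  ... | inj₂ (inj₂ q<q)       = <-irrefl refl q<q

  others-unique : Unique others
  others-unique =
    Unique.++⁺ (range-unique 1 p₀) (Unique.++⁺ (range-unique (suc p) d) (range-unique (suc q) e) middle) low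
    where
    middle : ∀ {v} → ¬ (v ∈ between × v ∈ above)
    middle (v∈m , v∈a) = <-asym (proj₂ (∈-range⁻ (suc p) d v∈m)) (proj₁ (∈-range⁻ (suc q) e v∈a))
    p<v : ∀ {v} → v ∈ between ⊎ v ∈ above → p < v
    p<v (inj₁ v∈m) = proj₁ (∈-range⁻ (suc p) d v∈m)
    p<v (inj₂ v∈a) = <-trans p<q (proj₁ (∈-range⁻ (suc q) e v∈a))
    low : ∀ {v} → ¬ (v ∈ below × v ∈ between ++ above)
    low (v∈b , v∈r) = <-asym (proj₂ (∈-range⁻ 1 p₀ v∈b)) (p<v (∈-++⁻ between v∈r))

  length-others : length others ≡ N
  length-others = begin
    length others                                   ≡⟨ length-++ below ⟩
    length below + length (between ++ above)        ≡⟨ cong (length below +_) (length-++ between) ⟩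
    length below + (length between + length above)
      ≡⟨ cong₂ _+_ (length-range 1 p₀) (cong₂ _+_ (length-range (suc p) d) (length-range (suc q) e)) ⟩
    p₀ + (d + e)                                    ≡⟨ sym (+-assoc p₀ d e) ⟩
    N                                               ∎
    where open ≡-Reasoning

  count-others : ∀ f → count f others ≡ count f below + (count f between + count f above)
  count-others f = trans (count-++ f below _) (cong (count f below +_) (count-++ f between above))

  count-small-others : count (_<ᵇ p) others ≡ p₀
  count-small-others = begin
    count (_<ᵇ p) others
      ≡⟨ count-others (_<ᵇ p) ⟩
    count (_<ᵇ p) below + (count (_<ᵇ p) between + count (_<ᵇ p) above)
      ≡⟨ cong₂ _+_ (count-range-true 1 p₀ (λ {i} _ i<p → dec-true (i <? p) i<p))
           (cong₂ _+_ (count-range-false (suc p) d (λ {i} p<i _ → dec-false (i <? p) (<-asym p<i)))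
                      (count-range-false (suc q) e (λ {i} q<i _ → dec-false (i <? p) (<-asym (<-trans p<q q<i))))) ⟩
    p₀ + 0
      ≡⟨ +-identityʳ p₀ ⟩
    p₀ ∎
    where open ≡-Reasoning

  count-large-others : count (q <ᵇ_) others ≡ e
  count-large-others = begin
    count (q <ᵇ_) others
      ≡⟨ count-others (q <ᵇ_) ⟩
    count (q <ᵇ_) below + (count (q <ᵇ_) between + count (q <ᵇ_) above)
      ≡⟨ cong₂ _+_ (count-range-false 1 p₀ (λ {i} _ i<p → dec-false (q <? i) (<-asym (<-trans i<p p<q))))
           (cong₂ _+_ (count-range-false (suc p) d (λ {i} _ i<q → dec-false (q <? i) (<-asym i<q)))
                      (count-range-true (suc q) e (λ {i} q<i _ → dec-true (q <? i) q<i))) ⟩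
    e ∎
    where open ≡-Reasoning

  count-not-small-others : count (not ∘ (_<ᵇ p)) others ≡ d + e
  count-not-small-others = +-cancelˡ-≡ p₀ _ _ (begin
    p₀ + count (not ∘ (_<ᵇ p)) others
      ≡⟨ cong (_+ count (not ∘ (_<ᵇ p)) others) (sym count-small-others) ⟩
    count (_<ᵇ p) others + count (not ∘ (_<ᵇ p)) others
      ≡⟨ count+count-not (_<ᵇ p) others ⟩
    length others
      ≡⟨ trans length-others (+-assoc p₀ d e) ⟩
    p₀ + (d + e) ∎)
    where open ≡-Reasoning

  Pval-frame : ∀ (w : Vec ℕ N) x y → Pval (frame w x y) ≡ x ⊓ y
  Pval-frame w x y = cong (x ⊓_) (frame-last w x y)

  Qval-frame : ∀ (w : Vec ℕ N) x y → Qval (frame w x y) ≡ x ⊔ y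
  Qval-frame w x y = cong (x ⊔_) (frame-last w x y)

  Ends : ℕ → ℕ → Set
  Ends x y = (x ≡ p × y ≡ q) ⊎ (x ≡ q × y ≡ p)

  Ends⇒Pval×Qval : ∀ (w : Vec ℕ N) {x y} → Ends x y → Pval (frame w x y) ≡ p × Qval (frame w x y) ≡ q
  Ends⇒Pval×Qval w (inj₁ (refl , refl)) =
    trans (Pval-frame w p q) (m≤n⇒m⊓n≡m (<⇒≤ p<q)) , trans (Qval-frame w p q) (m≤n⇒m⊔n≡n (<⇒≤ p<q))
  Ends⇒Pval×Qval w (inj₂ (refl , refl)) =
    trans (Pval-frame w q p) (m≥n⇒m⊓n≡n (<⇒≤ p<q)) , trans (Qval-frame w q p) (m≥n⇒m⊔n≡m (<⇒≤ p<q))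

  Pval×Qval⇒Ends : ∀ (w : Vec ℕ N) x y → Pval (frame w x y) ≡ p → Qval (frame w x y) ≡ q → Ends x y
  Pval×Qval⇒Ends w x y P≡p Q≡q with ≤-total x y
  ... | inj₁ x≤y = inj₁ (trans (sym (m≤n⇒m⊓n≡m x≤y)) (trans (sym (Pval-frame w x y)) P≡p)
                       , trans (sym (m≤n⇒m⊔n≡n x≤y)) (trans (sym (Qval-frame w x y)) Q≡q))
  ... | inj₂ y≤x = inj₂ (trans (sym (m≥n⇒m⊔n≡m y≤x)) (trans (sym (Qval-frame w x y)) Q≡q)
                       , trans (sym (m≥n⇒m⊓n≡n y≤x)) (trans (sym (Pval-frame w x y)) P≡p))

  ↭⇒IsPerm-frame : ∀ (w : Vec ℕ N) x y → x ∷ y ∷ toList w ↭ p ∷ q ∷ others → IsPerm n (frame w x y)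
  ↭⇒IsPerm-frame w x y xyw↭ = ↭-trans (frame-↭ w x y) (↭-trans xyw↭ others-↭)

  IsPerm-frame⇒↭ : ∀ (w : Vec ℕ N) x y → IsPerm n (frame w x y) → x ∷ y ∷ toList w ↭ p ∷ q ∷ others
  IsPerm-frame⇒↭ w x y perm = ↭-trans (↭-sym (frame-↭ w x y)) (↭-trans perm (↭-sym others-↭))

  sAtK-frame : ∀ (w : Vec ℕ N) {x y} → toList w ↭ others → Ends x y →
               sAtK (frame w x y) ≡ countPrefix (_<ᵇ p) (p₀ + d) w
  sAtK-frame w {x} {y} w↭ ends = begin
    sAtK v
      ≡⟨ cong₂ (λ P Q → length (filter (λ i → arr v i <? P) (outerLoop n n (arr v) P Q 2 (suc N) 2)))
               (proj₁ (Ends⇒Pval×Qval w ends)) (proj₂ (Ends⇒Pval×Qval w ends)) ⟩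
    length (filter (λ i → arr v i <? p) (outerLoop n n (arr v) p q 2 (suc N) 2))
      ≡⟨ small-visited (s≤s z≤n) (p₀ + d) (cong (p₀ + d +_) large-total) ⟩
    count (λ i → arr v i <ᵇ p) (range 2 (p₀ + d))
      ≡⟨ count-frame w x y (_<ᵇ p) (p₀ + d) (m≤m+n _ e) ⟩
    countPrefix (_<ᵇ p) (p₀ + d) w ∎
    where
    open ≡-Reasoning
    v = frame w x y
    q∉w : ∀ i → 2 ≤ i → i ≤ suc N → arr v i ≢ q
    q∉w (suc (suc i)) (s≤s (s≤s _)) (s≤s i<N) vᵢ≡q =
      q∉others (∈-resp-↭ w↭ (subst (_∈ toList w) vᵢ≡q (frame-inner w x y i i<N)))
    open Partition (arr v) (suc N) n p q using (largeIn)
    open Partition.Scan (arr v) (suc N) n p q (<⇒≤ p<q) q∉w (n≤1+n (suc N)) using (small-visited)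
    large-total : largeIn 2 N ≡ e
    large-total = begin
      count ((q <ᵇ_) ∘ arr v) (range 2 N) ≡⟨ count-frame w x y (q <ᵇ_) N ≤-refl ⟩
      count (q <ᵇ_) (take N (toList w))   ≡⟨ cong (count (q <ᵇ_)) (take-all N _ (≤-reflexive (Vec.length-toList w))) ⟩
      count (q <ᵇ_) (toList w)            ≡⟨ count-↭ (q <ᵇ_) w↭ ⟩
      count (q <ᵇ_) others                ≡⟨ count-large-others ⟩
      e                                   ∎

  Conditioned : Vec ℕ n → Set
  Conditioned A = IsPerm n A × Pval A ≡ p × Qval A ≡ q

  arrangedOthers : List (Vec ℕ N)
  arrangedOthers = arrangements N others

  framed : ℕ → ℕ → List (Vec ℕ n)
  framed x y = map (λ w → frame w x y) arrangedOthers

  conditioned : List (Vec ℕ n)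
  conditioned = framed p q ++ framed q p

  ∈-conditioned⁻ : ∀ A → A ∈ conditioned → Conditioned A
  ∈-conditioned⁻ A A∈ with ∈-++⁻ (framed p q) A∈
  ... | inj₁ A∈pq with w , w∈ , refl ← ∈-map⁻ _ A∈pq =
    ↭⇒IsPerm-frame w p q (prep p (prep q (∈-arrangements⁻ N others w∈))) , Ends⇒Pval×Qval w (inj₁ (refl , refl))
  ... | inj₂ A∈qp with w , w∈ , refl ← ∈-map⁻ _ A∈qp =
    ↭⇒IsPerm-frame w q p (↭-trans (↭.swap q p ↭-refl) (prep p (prep q (∈-arrangements⁻ N others w∈))))
    , Ends⇒Pval×Qval w (inj₂ (refl , refl))

  ∈-conditioned⁺ : ∀ A → Conditioned A → A ∈ conditioned
  ∈-conditioned⁺ (x ∷ t) (perm , P≡p , Q≡q) with initLast t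
  ... | w , y , refl with Pval×Qval⇒Ends w x y P≡p Q≡q
  ...   | inj₁ (refl , refl) =
    ∈-++⁺ˡ (∈-map⁺ _ (∈-arrangements⁺ N others w (drop-∷ (drop-∷ (IsPerm-frame⇒↭ w p q perm)))))
  ...   | inj₂ (refl , refl) =
    ∈-++⁺ʳ (framed p q) (∈-map⁺ _ (∈-arrangements⁺ N others w
      (drop-∷ (drop-∷ (↭-trans (↭.swap p q ↭-refl) (IsPerm-frame⇒↭ w q p perm))))))

  frame-injective : ∀ {x y} {w w′ : Vec ℕ N} → frame w x y ≡ frame w′ x y → w ≡ w′
  frame-injective {w = w} {w′} eq = Vec.∷ʳ-injectiveˡ w w′ (Vec.∷-injectiveʳ eq)

  conditioned-unique : Unique conditioned
  conditioned-unique =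
    Unique.++⁺ (Unique.map⁺ frame-injective arranged!) (Unique.map⁺ frame-injective arranged!) disjoint
    where
    arranged! = arrangements-unique N others others-unique
    disjoint : ∀ {A} → ¬ (A ∈ framed p q × A ∈ framed q p)
    disjoint (A∈pq , A∈qp) with _ , _ , refl ← ∈-map⁻ _ A∈pq | _ , _ , eq ← ∈-map⁻ _ A∈qp =
      <-irrefl (Vec.∷-injectiveˡ eq) p<q

  length-conditioned : length conditioned ≡ N ! + N !
  length-conditioned = trans (length-++ (framed p q)) (cong₂ _+_ (length-framed p q) (length-framed q p))
    where
    length-framed : ∀ x y → length (framed x y) ≡ N !
    length-framed x y = trans (length-map _ arrangedOthers) (length-arrangements N others length-others)

  module _ (j : ℕ) where

    events : List (Vec ℕ n)
    events = filter (λ A → sAtK A ≟ j) conditioned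

    ∈-events : ∀ A → A ∈ events ⇔ (Conditioned A × sAtK A ≡ j)
    ∈-events A = mk⇔
      (λ A∈ → let A∈c , sAtK≡j = ∈-filter⁻ (λ A → sAtK A ≟ j) A∈ in ∈-conditioned⁻ A A∈c , sAtK≡j)
      (λ (cond , sAtK≡j) → ∈-filter⁺ (λ A → sAtK A ≟ j) (∈-conditioned⁺ A cond) sAtK≡j)

    events-unique : Unique events
    events-unique = Unique.filter⁺ (λ A → sAtK A ≟ j) conditioned-unique

    count-framed : ∀ {x y} → Ends x y →
                   count (λ A → sAtK A ≡ᵇ j) (framed x y) ≡ hypCount p₀ (d + e) (p₀ + d) j
    count-framed {x} {y} ends = begin
      count (λ A → sAtK A ≡ᵇ j) (framed x y)
        ≡⟨ count-map _ _ arrangedOthers ⟩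
      count (λ w → sAtK (frame w x y) ≡ᵇ j) arrangedOthers
        ≡⟨ count-cong arrangedOthers (λ w∈ → cong (_≡ᵇ j) (sAtK-frame _ (∈-arrangements⁻ N others w∈) ends)) ⟩
      count (λ w → countPrefix (_<ᵇ p) (p₀ + d) w ≡ᵇ j) arrangedOthers
        ≡⟨ count-hits (_<ᵇ p) N others (p₀ + d) j length-others (m≤m+n _ e) ⟩
      hitCount (count (_<ᵇ p) others) (count (not ∘ (_<ᵇ p)) others) (p₀ + d) j
        ≡⟨ cong₂ (λ a b → hitCount a b (p₀ + d) j) count-small-others count-not-small-others ⟩
      hitCount p₀ (d + e) (p₀ + d) j
        ≡⟨ hitCount≡hypCount p₀ (d + e) (p₀ + d) j (subst (p₀ + d ≤_) (+-assoc p₀ d e) (m≤m+n _ e)) ⟩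
      hypCount p₀ (d + e) (p₀ + d) j ∎
      where open ≡-Reasoning

    length-events : length events ≡ hypCount p₀ (d + e) (p₀ + d) j + hypCount p₀ (d + e) (p₀ + d) j
    length-events = begin
      length events
        ≡⟨ length-filter (λ A → sAtK A ≟ j) conditioned ⟩
      count (λ A → sAtK A ≡ᵇ j) conditioned
        ≡⟨ count-++ _ (framed p q) (framed q p) ⟩
      count (λ A → sAtK A ≡ᵇ j) (framed p q) + count (λ A → sAtK A ≡ᵇ j) (framed q p)
        ≡⟨ cong₂ _+_ (count-framed (inj₁ (refl , refl))) (count-framed (inj₂ (refl , refl))) ⟩
      _ ∎
      where open ≡-Reasoning

    length-events*NCp₀≡length-conditioned*hypNum :
      length events * (N C p₀) ≡ length conditioned * hypNum p₀ (p₀ + d) N j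
    length-events*NCp₀≡length-conditioned*hypNum = begin
      length events * c      ≡⟨ cong (_* c) length-events ⟩
      (h′ * f + h′ * f) * c  ≡⟨ cong (λ t → (hypNum p₀ (p₀ + d) t j * f + hypNum p₀ (p₀ + d) t j * f) * c)
                                     (sym (+-assoc p₀ d e)) ⟩
      (h * f + h * f) * c    ≡⟨ rearrange h f c ⟩
      (c * f + c * f) * h    ≡⟨ cong (λ t → (t + t) * h) c*f≡N! ⟩
      (N ! + N !) * h        ≡⟨ cong (_* h) (sym length-conditioned) ⟩
      length conditioned * h ∎
      where
      open ≡-Reasoning
      c = N C p₀
      f = p₀ ! * (d + e) !
      h = hypNum p₀ (p₀ + d) N j
      h′ = hypNum p₀ (p₀ + d) (p₀ + (d + e)) j
      N∸p₀≡d+e : N ∸ p₀ ≡ d + e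
      N∸p₀≡d+e = trans (cong (_∸ p₀) (+-assoc p₀ d e)) (m+n∸m≡n p₀ (d + e))
      c*f≡N! : c * f ≡ N !
      c*f≡N! = subst (λ t → c * (p₀ ! * t !) ≡ N !) N∸p₀≡d+e
                     (nCk*[k!*[n∸k]!]≡n! (≤-trans (m≤m+n p₀ d) (m≤m+n (p₀ + d) e)))
      rearrange : ∀ h f c → (h * f + h * f) * c ≡ (c * f + c * f) * h
      rearrange = solve-∀

lemma3p7 : (n : ℕ) → 3 ≤ n → (p q : ℕ) → 1 ≤ p → p < q → q ≤ n → (j : ℕ) →
    ∃[ Cond ] ∃[ Ev ]
      ( Unique Cond × ((A : Vec ℕ n) → (A ∈ Cond) ⇔ (IsPerm n A × Pval A ≡ p × Qval A ≡ q))
      × Unique Ev × ((A : Vec ℕ n) → (A ∈ Ev) ⇔ ((IsPerm n A × Pval A ≡ p × Qval A ≡ q) × sAtK A ≡ j))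
      × length Ev * ((n ∸ 2) C (p ∸ 1)) ≡ length Cond * hypNum (p ∸ 1) (q ∸ 2) (n ∸ 2) j )
lemma3p7 _ _ (suc p₀) _ (s≤s z≤n) p<q q≤n j
  with d , refl ← m≤n⇒∃[o]m+o≡n p<q
  with e , refl ← m≤n⇒∃[o]m+o≡n q≤n =
  conditioned , events j
  , conditioned-unique , (λ A → mk⇔ (∈-conditioned⁻ A) (∈-conditioned⁺ A))
  , events-unique j , ∈-events j
  , length-events*NCp₀≡length-conditioned*hypNum j
  where open Pivots p₀ d e
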